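{- $\mathrm{OPT}(T) \le \mathrm{OPT}(S) + w(\mathrm{CYC}(G_S)) \le 2\,\mathrm{OPT}(S)$.
   Context: SCS-RC: given $S=\{s_1,\dots,s_m\}$ over $\{\texttt a,\texttt t,\texttt g,\texttt c\}$, find a shortest string containing, for each $i$, $s_i$ or its reverse complement $\bar{s_i}^R$; $\mathrm{OPT}(\cdot)$ is the optimal length. Assume $S\cup\bar{S}^R$ is substring-free. For strings $x,y$, $\mathrm{ov}(x,y)$ is the length of the longest $v$ with $x=uv$, $y=vw$, $u,w$ nonempty; $\mathrm{pref}(x,y)=u$ and $\mathrm{dist}(x,y)=|x|-\mathrm{ov}(x,y)$. The distance graph $G_S$ is the complete directed graph on $S\cup\bar{S}^R$ with edge weights $\mathrm{dist}(x,y)$; a cycle cover is a set of vertex-disjoint cycles containing exactly one of $s_i,\bar{s_i}^R$ for each $i$, its weight is the sum of edge weights, and $\mathrm{CYC}(G_S)$ denotes an optimal (minimum-weight) cycle cover, with $w(\mathrm{CYC}(G_S))\le \mathrm{OPT}(S)$. \textsf{MGREEDY-RC} produces $\mathrm{CYC}(G_S)$ and a set $T$ containing, for each cycle $C=s_{i_1}',\dots,s_{i_r}',s_{i_1}'$ (where $s'\in\{s,\bar{s}^R\}$), the string $\mathrm{pref}(s_{i_1}',s_{i_2}')\cdots\mathrm{pref}(s_{i_{r-1}}',s_{i_r}')s_{i_r}'$. -}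

module Defs where

open import Data.Nat using (ℕ; zero; suc; _+_; _∸_; _⊔_; _⊓_; _≤_)
open import Data.Bool using (Bool; true; false)
open import Data.Fin using (Fin)
open import Data.List using (List; []; _∷_; _++_; [_]; length; map; reverse; take; drop; filter; upTo; foldr; tabulate; allFin; concat)
open import Data.List.NonEmpty using (List⁺; _∷_; toList)
import Data.List.Properties as LP
open import Data.Nat.ListAction using (sum)
open import Data.List.Relation.Unary.All using (All)
open import Data.List.Relation.Binary.Permutation.Propositional using (_↭_)
open import Data.Product using (Σ; ∃; ∃-syntax; _×_; _,_; proj₁)
open import Data.Sum using (_⊎_)
open import Relation.Binary.PropositionalEquality using (_≡_; refl)
open import Relation.Nullary using (yes; no)
open import Relation.Binary.Definitions using (DecidableEquality)

data Base : Set where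
  a t g c : Base

_≟B_ : DecidableEquality Base
a ≟B a = yes refl
a ≟B t = no λ ()
a ≟B g = no λ ()
a ≟B c = no λ ()
t ≟B a = no λ ()
t ≟B t = yes refl
t ≟B g = no λ ()
t ≟B c = no λ ()
g ≟B a = no λ ()
g ≟B t = no λ ()
g ≟B g = yes refl
g ≟B c = no λ ()
c ≟B a = no λ ()
c ≟B t = no λ ()
c ≟B g = no λ ()
c ≟B c = yes refl

Str : Set
Str = List Base

_≟S_ : DecidableEquality Str
_≟S_ = LP.≡-dec _≟B_

comp : Base → Base
comp a = t
comp t = a
comp g = c
comp c = g

rc : Str → Str
rc x = reverse (map comp x)

_⊑_ : Str → Str → Set
x ⊑ y = ∃[ u ] ∃[ v ] (u ++ x ++ v ≡ y)

-- ov(x,y): the length of the longest v with x = uv, y = vw, u,w nonempty;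
-- i.e. the largest k < |x|, k < |y| such that the length-k suffix of x
-- equals the length-k prefix of y (k = 0 always qualifies).
ov : Str → Str → ℕ
ov x y = foldr _⊔_ 0
  (filter (λ k → drop (length x ∸ k) x ≟S take k y) (upTo (length x ⊓ length y)))

pref : Str → Str → Str
pref x y = take (length x ∸ ov x y) x

dist : Str → Str → ℕ
dist x y = length x ∸ ov x y

Solves : List Str → Str → Set
Solves L z = All (λ s → (s ⊑ z) ⊎ (rc s ⊑ z)) L

IsOPT : List Str → ℕ → Set
IsOPT L n = (∃[ z ] (Solves L z × length z ≡ n)) × (∀ z → Solves L z → n ≤ length z)

Instance : ℕ → Set
Instance m = Fin m → Str

Vertex : ℕ → Set
Vertex m = Fin m × Bool

str : ∀ {m} → Instance m → Vertex m → Str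
str S (i , false) = S i
str S (i , true)  = rc (S i)

-- S ∪ S̄^R is substring-free: no s_i' is a substring of s_j' for distinct
-- members i ≠ j (reading: the strings s_1..s_m are distinct elements
-- of S, also up to reverse complement).
SubstringFree : ∀ {m} → Instance m → Set
SubstringFree {m} S = ∀ (x y : Vertex m) → str S x ⊑ str S y → proj₁ x ≡ proj₁ y

-- a cycle s'_{i1}, …, s'_{ir}, s'_{i1} is given by the nonempty list of its vertices;
-- a cycle cover is a list of cycles
Cycle : ℕ → Set
Cycle m = List⁺ (Vertex m)

CycleCover : ℕ → Set
CycleCover m = List (Cycle m)

-- vertex-disjoint and containing exactly one of s_i, s̄_i^R for each i
IsCycleCover : ∀ {m} → CycleCover m → Set
IsCycleCover {m} C = map proj₁ (concat (map toList C)) ↭ allFin m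

pathWeight : List Str → ℕ
pathWeight (x ∷ y ∷ r) = dist x y + pathWeight (y ∷ r)
pathWeight _ = 0

cycleWeight : ∀ {m} → Instance m → Cycle m → ℕ
cycleWeight S (v ∷ vs) = pathWeight (map (str S) ((v ∷ vs) ++ [ v ]))

weight : ∀ {m} → Instance m → CycleCover m → ℕ
weight S C = sum (map (cycleWeight S) C)

IsOptimalCycleCover : ∀ {m} → Instance m → CycleCover m → Set
IsOptimalCycleCover S C =
  IsCycleCover C × (∀ C' → IsCycleCover C' → weight S C ≤ weight S C')

chainString : Str → List Str → Str
chainString x [] = x
chainString x (y ∷ r) = pref x y ++ chainString y r

cycleString : ∀ {m} → Instance m → Cycle m → Str
cycleString S (v ∷ vs) = chainString (str S v) (map (str S) vs)

Tset : ∀ {m} → Instance m → CycleCover m → List Str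
Tset S C = map (cycleString S) C

asList : ∀ {m} → Instance m → List Str
asList S = tabulate S

-- A shortest solution z of S contains, for each i, an occurrence of s_i or of its reverse
-- complement; ordered by starting position these give a transversal P of G_S. Since S ∪ S̄^R is
-- substring-free, consecutive occurrences x, y start at least dist(x,y) apart, so merging the strings
-- of P along their overlaps yields a string of length at most |z| = OPT(S). The single cycle through P
-- weighs no more than this merge, as its closing edge costs at most the length of the last string;
-- whence w(CYC) ≤ OPT(S).
-- For T, extend P by a detour around each cycle of CYC at the vertex of P carrying the index of the
-- cycle's first vertex, traversing the cycle reversed and complemented when that vertex has the other
-- orientation; this keeps the weight of the cycle. The merge of the resulting walk is w(CYC) longer
-- than the merge of P and contains every string of T or its reverse complement.
module Submission where

open import Defs
open import Data.Bool using (true; false)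
import Data.Bool.Properties as Boolₚ
open import Data.Empty using (⊥-elim)
open import Data.Fin using (Fin; zero; suc)
import Data.Fin.Properties as Finₚ
open import Data.List
  using (List; []; _∷_; _++_; [_]; length; map; reverse; take; drop; filter; upTo; foldr; tabulate; concatMap;
         allFin; initLast; _∷ʳ′_)
open import Data.List.Properties
open import Data.List.Membership.Propositional using (_∈_)
open import Data.List.Membership.Propositional.Properties
  using (∈-filter⁻; ∈-filter⁺; ∈-upTo⁺; ∈-upTo⁻; ∈-∃++; ∈-map⁻; ∈-allFin)
open import Data.List.NonEmpty using (List⁺) renaming (_∷_ to _∷⁺_)
open import Data.List.Relation.Binary.Permutation.Propositional using (_↭_; ↭-sym; ↭⇒↭ₛ)
open import Data.List.Relation.Binary.Permutation.Propositional.Properties using (map⁺; ∈-resp-↭)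
open import Data.List.Relation.Binary.Permutation.Setoid.Properties using (Unique-resp-↭)
open import Data.List.Relation.Unary.All as All using (_∷_)
open import Data.List.Relation.Unary.All.Properties using (tabulate⁻) renaming (map⁺ to All-map⁺)
open import Data.List.Relation.Unary.AllPairs using (_∷_)
open import Data.List.Relation.Unary.Any using (here; there)
open import Data.List.Relation.Unary.Linked using (Linked; _∷_)
open import Data.List.Relation.Unary.Unique.Propositional using (Unique)
open import Data.List.Relation.Unary.Unique.Propositional.Properties using (allFin⁺)
open import Data.Nat using (ℕ; zero; suc; _+_; _*_; _≤_; _<_; _∸_; _⊔_; _⊓_; z≤n; s≤s)
open import Data.Nat.ListAction using (sum)
open import Data.Nat.ListAction.Properties using (sum-↭)
open import Data.Nat.Properties
open import Algebra.Properties.CommutativeSemigroup +-commutativeSemigroup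
  using (interchange; xy∙z≈xz∙y; x∙yz≈y∙xz)
open import Data.Product using (_×_; _,_; proj₁; proj₂; Σ; ∃-syntax)
open import Data.Sum as Sum using (_⊎_; inj₁; inj₂)
open import Function using (_∘_)
open import Relation.Binary.PropositionalEquality hiding ([_])
import Relation.Binary.Construct.On as On
open import Relation.Nullary using (¬_; Dec; yes; no)

maximum : List ℕ → ℕ
maximum = foldr _⊔_ 0

≤-maximum : ∀ {k ns} → k ∈ ns → k ≤ maximum ns
≤-maximum {ns = ns} = All.lookup (foldr-forcesᵇ split 0 ns ≤-refl)
  where
  split : ∀ m n → m ⊔ n ≤ maximum ns → m ≤ maximum ns × n ≤ maximum ns
  split m n le = m⊔n≤o⇒m≤o m n le , m⊔n≤o⇒n≤o m n le

maximum-∈ : ∀ ns → maximum ns ≡ 0 ⊎ maximum ns ∈ ns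
maximum-∈ [] = inj₁ refl
maximum-∈ (n ∷ ns) with ⊔-sel n (maximum ns) | maximum-∈ ns
... | inj₁ eq | _        = inj₂ (here eq)
... | inj₂ eq | inj₁ eq′ = inj₁ (trans eq eq′)
... | inj₂ eq | inj₂ ∈ns = inj₂ (there (subst (_∈ ns) (sym eq) ∈ns))

module _ {A : Set} where

  ++-split : ∀ (p q r s : List A) → p ++ q ≡ r ++ s →
             (∃[ e ] (r ≡ p ++ e × q ≡ e ++ s)) ⊎ (∃[ e ] (p ≡ r ++ e × s ≡ e ++ q))
  ++-split []      q r       s eq = inj₁ (r , refl , eq)
  ++-split (x ∷ p) q []      s eq = inj₂ (x ∷ p , refl , sym eq)
  ++-split (x ∷ p) q (y ∷ r) s eq with ∷-injective eq
  ... | refl , eq′ with ++-split p q r s eq′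
  ...   | inj₁ (e , r≡ , q≡) = inj₁ (e , cong (x ∷_) r≡ , q≡)
  ...   | inj₂ (e , p≡ , s≡) = inj₂ (e , cong (x ∷_) p≡ , s≡)

  ++-split-≤ : ∀ (p q r s : List A) → p ++ q ≡ r ++ s → length p ≤ length r →
               ∃[ e ] (r ≡ p ++ e × q ≡ e ++ s)
  ++-split-≤ []      q r       s eq _          = r , refl , eq
  ++-split-≤ (x ∷ p) q (y ∷ r) s eq (s≤s p≤r) with ∷-injective eq
  ... | refl , eq′ with ++-split-≤ p q r s eq′ p≤r
  ...   | e , r≡ , q≡ = e , cong (x ∷_) r≡ , q≡

  drop-length-++ : ∀ (p q : List A) → drop (length p) (p ++ q) ≡ q
  drop-length-++ []      q = refl
  drop-length-++ (x ∷ p) q = drop-length-++ p q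

  take-length-++ : ∀ (p q : List A) → take (length p) (p ++ q) ≡ p
  take-length-++ []      q = refl
  take-length-++ (x ∷ p) q = cong (x ∷_) (take-length-++ p q)

  reverse-take : ∀ k (xs : List A) → reverse (take k xs) ≡ drop (length xs ∸ k) (reverse xs)
  reverse-take k xs = begin
    reverse (take k xs)
      ≡⟨ drop-length-++ (reverse (drop k xs)) (reverse (take k xs)) ⟨
    drop (length (reverse (drop k xs))) (reverse (drop k xs) ++ reverse (take k xs))
      ≡⟨ cong₂ drop (trans (length-reverse (drop k xs)) (length-drop k xs))
                    (sym (reverse-++ (take k xs) (drop k xs))) ⟩
    drop (length xs ∸ k) (reverse (take k xs ++ drop k xs))
      ≡⟨ cong (drop (length xs ∸ k) ∘ reverse) (take++drop≡id k xs) ⟩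
    drop (length xs ∸ k) (reverse xs) ∎
    where open ≡-Reasoning

  reverse-drop : ∀ k (xs : List A) → k ≤ length xs →
                 reverse (drop (length xs ∸ k) xs) ≡ take k (reverse xs)
  reverse-drop k xs k≤ = begin
    reverse (drop j xs)
      ≡⟨ take-length-++ (reverse (drop j xs)) (reverse (take j xs)) ⟨
    take (length (reverse (drop j xs))) (reverse (drop j xs) ++ reverse (take j xs))
      ≡⟨ cong₂ take (trans (length-reverse (drop j xs)) (trans (length-drop j xs) (m∸[m∸n]≡n k≤)))
                    (sym (reverse-++ (take j xs) (drop j xs))) ⟩
    take k (reverse (take j xs ++ drop j xs))
      ≡⟨ cong (take k ∘ reverse) (take++drop≡id j xs) ⟩
    take k (reverse xs) ∎
    where open ≡-Reasoning
          j : ℕ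
          j = length xs ∸ k

  Infix : List A → List A → Set
  Infix ks ws = ∃[ p ] ∃[ q ] (p ++ ks ++ q ≡ ws)

  infix-trans : ∀ {xs ys zs} → Infix xs ys → Infix ys zs → Infix xs zs
  infix-trans {xs} (p , q , refl) (p′ , q′ , refl) = p′ ++ p , q ++ q′ , (begin
    (p′ ++ p) ++ xs ++ q ++ q′   ≡⟨ ++-assoc p′ p _ ⟩
    p′ ++ p ++ xs ++ q ++ q′     ≡⟨ cong (λ l → p′ ++ p ++ l) (++-assoc xs q q′) ⟨
    p′ ++ p ++ (xs ++ q) ++ q′   ≡⟨ cong (p′ ++_) (++-assoc p (xs ++ q) q′) ⟨
    p′ ++ (p ++ xs ++ q) ++ q′   ∎)
    where open ≡-Reasoning

  infix-++ˡ : ∀ {ks ws} xs → Infix ks ws → Infix ks (xs ++ ws)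
  infix-++ˡ xs (p , q , eq) = xs ++ p , q , trans (++-assoc xs p _) (cong (xs ++_) eq)

  infix-++ʳ : ∀ {ks ws} xs → Infix ks ws → Infix ks (ws ++ xs)
  infix-++ʳ {ks} {ws} xs (p , q , eq) = p , q ++ xs , (begin
    p ++ ks ++ q ++ xs   ≡⟨ cong (p ++_) (++-assoc ks q xs) ⟨
    p ++ (ks ++ q) ++ xs ≡⟨ ++-assoc p (ks ++ q) xs ⟨
    (p ++ ks ++ q) ++ xs ≡⟨ cong (_++ xs) eq ⟩
    ws ++ xs             ∎)
    where open ≡-Reasoning

sum-map-+ : ∀ {A : Set} (f h : A → ℕ) xs → sum (map (λ x → f x + h x) xs) ≡ sum (map f xs) + sum (map h xs)
sum-map-+ f h []       = refl
sum-map-+ f h (x ∷ xs) =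
  trans (cong (f x + h x +_) (sum-map-+ f h xs)) (interchange (f x) (h x) (sum (map f xs)) (sum (map h xs)))

sum-map-0 : ∀ {A : Set} (xs : List A) → sum (map (λ _ → 0) xs) ≡ 0
sum-map-0 []       = refl
sum-map-0 (_ ∷ xs) = sum-map-0 xs

sum-map-comm : ∀ {A B : Set} (f : A → B → ℕ) (xs : List A) (ys : List B) →
               sum (map (λ y → sum (map (λ x → f x y) xs)) ys) ≡ sum (map (λ x → sum (map (f x) ys)) xs)
sum-map-comm f xs []       = sym (sum-map-0 xs)
sum-map-comm f xs (y ∷ ys) = trans (cong (sum (map (λ x → f x y) xs) +_) (sum-map-comm f xs ys))
                                   (sym (sum-map-+ (λ x → f x y) (λ x → sum (map (f x) ys)) xs))

sum-tabulate-indicator : ∀ {m} (h : Fin m → ℕ) j → (∀ i → j ≢ i → h i ≡ 0) → sum (tabulate h) ≡ h j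
sum-tabulate-indicator {suc m} h zero    h≡0 =
  trans (cong (h zero +_) (sum-tabulate-0 (h ∘ suc) (λ i → h≡0 (suc i) λ ()))) (+-identityʳ (h zero))
  where
  sum-tabulate-0 : ∀ {n} (f : Fin n → ℕ) → (∀ i → f i ≡ 0) → sum (tabulate f) ≡ 0
  sum-tabulate-0 {zero}  f f≡0 = refl
  sum-tabulate-0 {suc n} f f≡0 = cong₂ _+_ (f≡0 zero) (sum-tabulate-0 (f ∘ suc) (f≡0 ∘ suc))
sum-tabulate-indicator {suc m} h (suc j) h≡0 =
  cong₂ _+_ (h≡0 zero λ ())
            (sum-tabulate-indicator (h ∘ suc) j λ i j≢i → h≡0 (suc i) (j≢i ∘ Finₚ.suc-injective))

comp-involutive : ∀ b → comp (comp b) ≡ b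
comp-involutive a = refl
comp-involutive t = refl
comp-involutive g = refl
comp-involutive c = refl

rc-involutive : ∀ x → rc (rc x) ≡ x
rc-involutive x = begin
  reverse (map comp (reverse (map comp x))) ≡⟨ cong reverse (reverse-map comp (map comp x)) ⟩
  reverse (reverse (map comp (map comp x))) ≡⟨ reverse-involutive _ ⟩
  map comp (map comp x)                     ≡⟨ map-∘ x ⟨
  map (comp ∘ comp) x                       ≡⟨ map-cong comp-involutive x ⟩
  map (λ b → b) x                           ≡⟨ map-id x ⟩
  x                                         ∎
  where open ≡-Reasoning

rc-++ : ∀ x y → rc (x ++ y) ≡ rc y ++ rc x
rc-++ x y = trans (cong reverse (map-++ comp x y)) (reverse-++ (map comp x) (map comp y))

length-rc : ∀ x → length (rc x) ≡ length x
length-rc x = trans (length-reverse (map comp x)) (length-map comp x)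

rc-take : ∀ k y → rc (take k y) ≡ drop (length y ∸ k) (rc y)
rc-take k y = begin
  reverse (map comp (take k y))               ≡⟨ cong reverse (take-map k y) ⟨
  reverse (take k (map comp y))               ≡⟨ reverse-take k (map comp y) ⟩
  drop (length (map comp y) ∸ k) (rc y)       ≡⟨ cong (λ n → drop (n ∸ k) (rc y)) (length-map comp y) ⟩
  drop (length y ∸ k) (rc y)                  ∎
  where open ≡-Reasoning

rc-drop : ∀ k x → k ≤ length x → rc (drop (length x ∸ k) x) ≡ take k (rc x)
rc-drop k x k≤ = begin
  reverse (map comp (drop (length x ∸ k) x))
    ≡⟨ cong reverse (drop-map (length x ∸ k) x) ⟨
  reverse (drop (length x ∸ k) (map comp x))
    ≡⟨ cong (λ n → reverse (drop (n ∸ k) (map comp x))) (length-map comp x) ⟨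
  reverse (drop (length (map comp x) ∸ k) (map comp x))
    ≡⟨ reverse-drop k (map comp x) (subst (k ≤_) (sym (length-map comp x)) k≤) ⟩
  take k (rc x)
    ∎
  where open ≡-Reasoning

Overlap : Str → Str → ℕ → Set
Overlap x y k = drop (length x ∸ k) x ≡ take k y

overlap? : ∀ x y k → Dec (Overlap x y k)
overlap? x y k = drop (length x ∸ k) x ≟S take k y

ov-maximal : ∀ x y k → k < length x ⊓ length y → Overlap x y k → k ≤ ov x y
ov-maximal x y k k< o = ≤-maximum (∈-filter⁺ (overlap? x y) (∈-upTo⁺ k<) o)

-- The first case includes the default value 0 of the maximum of an empty list, when x or y is empty.
ov≡0⊎ov< : ∀ x y → ov x y ≡ 0 ⊎ (ov x y < length x ⊓ length y × Overlap x y (ov x y))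
ov≡0⊎ov< x y with maximum-∈ (filter (overlap? x y) (upTo (length x ⊓ length y)))
... | inj₁ ov≡0 = inj₁ ov≡0
... | inj₂ ov∈ with ∈-filter⁻ (overlap? x y) ov∈
...   | ∈upTo , o = inj₂ (∈-upTo⁻ ∈upTo , o)

overlap-ov : ∀ x y → Overlap x y (ov x y)
overlap-ov x y with ov≡0⊎ov< x y
... | inj₂ (_ , o) = o
... | inj₁ ov≡0 rewrite ov≡0 = drop-all (length x ∸ 0) x ≤-refl

ov≤⊓ : ∀ x y → ov x y ≤ length x ⊓ length y
ov≤⊓ x y with ov≡0⊎ov< x y
... | inj₁ ov≡0 = subst (_≤ length x ⊓ length y) (sym ov≡0) z≤n
... | inj₂ (ov< , _) = <⇒≤ ov<

ov≤ˡ : ∀ x y → ov x y ≤ length x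
ov≤ˡ x y = ≤-trans (ov≤⊓ x y) (m⊓n≤m (length x) (length y))

ov≤ʳ : ∀ x y → ov x y ≤ length y
ov≤ʳ x y = ≤-trans (ov≤⊓ x y) (m⊓n≤n (length x) (length y))

overlap-rc : ∀ x y k → k ≤ length x → k ≤ length y → Overlap x y k → Overlap (rc y) (rc x) k
overlap-rc x y k k≤x k≤y o = begin
  drop (length (rc y) ∸ k) (rc y) ≡⟨ cong (λ n → drop (n ∸ k) (rc y)) (length-rc y) ⟩
  drop (length y ∸ k) (rc y)      ≡⟨ rc-take k y ⟨
  rc (take k y)                   ≡⟨ cong rc o ⟨
  rc (drop (length x ∸ k) x)      ≡⟨ rc-drop k x k≤x ⟩
  take k (rc x)                   ∎
  where open ≡-Reasoning

ov≤ov-rc : ∀ x y → ov x y ≤ ov (rc y) (rc x)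
ov≤ov-rc x y with ov≡0⊎ov< x y
... | inj₁ ov≡0 = subst (_≤ ov (rc y) (rc x)) (sym ov≡0) z≤n
... | inj₂ (ov< , o) = ov-maximal (rc y) (rc x) (ov x y) ov<′
                         (overlap-rc x y (ov x y) (ov≤ˡ x y) (ov≤ʳ x y) o)
  where
  ov<′ : ov x y < length (rc y) ⊓ length (rc x)
  ov<′ rewrite length-rc x | length-rc y = subst (ov x y <_) (⊓-comm (length x) (length y)) ov<

ov-rc : ∀ x y → ov (rc y) (rc x) ≡ ov x y
ov-rc x y = ≤-antisym
  (subst₂ (λ u v → ov (rc y) (rc x) ≤ ov u v) (rc-involutive x) (rc-involutive y) (ov≤ov-rc (rc y) (rc x)))
  (ov≤ov-rc x y)

pref-++ : ∀ x y → pref x y ++ y ≡ x ++ drop (ov x y) y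
pref-++ x y = begin
  take j x ++ y                        ≡⟨ cong (take j x ++_) (take++drop≡id (ov x y) y) ⟨
  take j x ++ (take (ov x y) y ++ r)   ≡⟨ ++-assoc (take j x) _ _ ⟨
  (take j x ++ take (ov x y) y) ++ r   ≡⟨ cong (λ w → (take j x ++ w) ++ r) (overlap-ov x y) ⟨
  (take j x ++ drop j x) ++ r          ≡⟨ cong (_++ r) (take++drop≡id j x) ⟩
  x ++ r                               ∎
  where open ≡-Reasoning
        j : ℕ
        j = length x ∸ ov x y
        r : Str
        r = drop (ov x y) y

length-pref : ∀ x y → length (pref x y) ≡ dist x y
length-pref x y = trans (length-take (length x ∸ ov x y) x) (m≤n⇒m⊓n≡m (m∸n≤m (length x) (ov x y)))

length-pref-++ : ∀ x y w → length (pref x y ++ w) ≡ dist x y + length w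
length-pref-++ x y w = trans (length-++ (pref x y)) (cong (_+ length w) (length-pref x y))

rc-pref : ∀ x y → rc (pref x y) ≡ drop (ov x y) (rc x)
rc-pref x y = trans (rc-take (length x ∸ ov x y) x) (cong (λ n → drop n (rc x)) (m∸[m∸n]≡n (ov≤ˡ x y)))

merge : List Str → Str
merge []       = []
merge (x ∷ ys) = chainString x ys

prefs : List Str → Str
prefs (x ∷ y ∷ zs) = pref x y ++ prefs (y ∷ zs)
prefs _            = []

length-prefs : ∀ xs → length (prefs xs) ≡ pathWeight xs
length-prefs []           = refl
length-prefs (x ∷ [])     = refl
length-prefs (x ∷ y ∷ zs) = trans (length-++ (pref x y)) (cong₂ _+_ (length-pref x y) (length-prefs (y ∷ zs)))

merge-++ : ∀ xs y ys → merge (xs ++ y ∷ ys) ≡ prefs (xs ++ [ y ]) ++ merge (y ∷ ys)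
merge-++ []           y ys = refl
merge-++ (x ∷ [])     y ys = cong (_++ merge (y ∷ ys)) (sym (++-identityʳ (pref x y)))
merge-++ (x ∷ x′ ∷ xs) y ys =
  trans (cong (pref x x′ ++_) (merge-++ (x′ ∷ xs) y ys)) (sym (++-assoc (pref x x′) _ _))

pathWeight-++ : ∀ xs y ys → pathWeight (xs ++ y ∷ ys) ≡ pathWeight (xs ++ [ y ]) + pathWeight (y ∷ ys)
pathWeight-++ []            y ys = refl
pathWeight-++ (x ∷ [])      y ys = cong (_+ pathWeight (y ∷ ys)) (sym (+-identityʳ (dist x y)))
pathWeight-++ (x ∷ x′ ∷ xs) y ys =
  trans (cong (dist x x′ +_) (pathWeight-++ (x′ ∷ xs) y ys)) (sym (+-assoc (dist x x′) _ _))

length-merge-∷ʳ : ∀ xs y → length (merge (xs ++ [ y ])) ≡ pathWeight (xs ++ [ y ]) + length y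
length-merge-∷ʳ xs y = begin
  length (merge (xs ++ [ y ]))               ≡⟨ cong length (merge-++ xs y []) ⟩
  length (prefs (xs ++ [ y ]) ++ y)          ≡⟨ length-++ (prefs (xs ++ [ y ])) ⟩
  length (prefs (xs ++ [ y ])) + length y    ≡⟨ cong (_+ length y) (length-prefs (xs ++ [ y ])) ⟩
  pathWeight (xs ++ [ y ]) + length y        ∎
  where open ≡-Reasoning

pathWeight-∷ʳ≤length-merge : ∀ xs x → pathWeight (xs ++ [ x ]) ≤ length (merge xs)
pathWeight-∷ʳ≤length-merge xs x with initLast xs
... | []        = z≤n
... | ys ∷ʳ′ y  = begin
  pathWeight ((ys ++ [ y ]) ++ [ x ])          ≡⟨ cong pathWeight (++-assoc ys [ y ] [ x ]) ⟩
  pathWeight (ys ++ y ∷ [ x ])                 ≡⟨ pathWeight-++ ys y [ x ] ⟩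
  pathWeight (ys ++ [ y ]) + (dist y x + 0)    ≡⟨ cong (pathWeight (ys ++ [ y ]) +_) (+-identityʳ (dist y x)) ⟩
  pathWeight (ys ++ [ y ]) + dist y x          ≤⟨ +-monoʳ-≤ (pathWeight (ys ++ [ y ])) (m∸n≤m (length y) (ov y x)) ⟩
  pathWeight (ys ++ [ y ]) + length y          ≡⟨ length-merge-∷ʳ ys y ⟨
  length (merge (ys ++ [ y ]))                 ∎
  where open ≤-Reasoning

merge-∷-extends : ∀ x ys → ∃[ w ] merge (x ∷ ys) ≡ x ++ w
merge-∷-extends x []       = [] , sym (++-identityʳ x)
merge-∷-extends x (y ∷ ys) with merge-∷-extends y ys
... | w , eq = drop (ov x y) y ++ w , (begin
  pref x y ++ merge (y ∷ ys)    ≡⟨ cong (pref x y ++_) eq ⟩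
  pref x y ++ y ++ w            ≡⟨ ++-assoc (pref x y) y w ⟨
  (pref x y ++ y) ++ w          ≡⟨ cong (_++ w) (pref-++ x y) ⟩
  (x ++ drop (ov x y) y) ++ w   ≡⟨ ++-assoc x _ w ⟩
  x ++ drop (ov x y) y ++ w     ∎)
  where open ≡-Reasoning

merge-++-extends : ∀ ks qs → ∃[ w ] merge (ks ++ qs) ≡ merge ks ++ w
merge-++-extends []            qs = merge qs , refl
merge-++-extends (k ∷ [])      qs = merge-∷-extends k qs
merge-++-extends (k ∷ k′ ∷ ks) qs with merge-++-extends (k′ ∷ ks) qs
... | w , eq = w , trans (cong (pref k k′ ++_) eq) (sym (++-assoc (pref k k′) _ w))

merge-infix : ∀ {ks ws} → Infix ks ws → merge ks ⊑ merge ws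
merge-infix {[]}     {ws} _              = [] , merge ws , refl
merge-infix {k ∷ ks} (p , q , refl) with merge-++-extends (k ∷ ks) q
... | w , eq = prefs (p ++ [ k ]) , w , sym (trans (merge-++ p k (ks ++ q)) (cong (prefs (p ++ [ k ]) ++_) eq))

merge-∷ʳ-∷ʳ : ∀ xs x y → merge (xs ++ x ∷ [ y ]) ≡ merge (xs ++ [ x ]) ++ drop (ov x y) y
merge-∷ʳ-∷ʳ xs x y = begin
  merge (xs ++ x ∷ [ y ])                 ≡⟨ merge-++ xs x [ y ] ⟩
  P ++ (pref x y ++ y)                    ≡⟨ cong (P ++_) (pref-++ x y) ⟩
  P ++ (x ++ drop (ov x y) y)             ≡⟨ ++-assoc P x _ ⟨
  (P ++ x) ++ drop (ov x y) y             ≡⟨ cong (_++ drop (ov x y) y) (merge-++ xs x []) ⟨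
  merge (xs ++ [ x ]) ++ drop (ov x y) y  ∎
  where open ≡-Reasoning
        P : Str
        P = prefs (xs ++ [ x ])

reverse-map-rc-∷-∷ : ∀ x y zs → reverse (map rc (x ∷ y ∷ zs)) ≡ reverse (map rc zs) ++ rc y ∷ [ rc x ]
reverse-map-rc-∷-∷ x y zs = begin
  reverse (rc x ∷ rc y ∷ map rc zs)              ≡⟨ unfold-reverse (rc x) (rc y ∷ map rc zs) ⟩
  reverse (rc y ∷ map rc zs) ++ [ rc x ]         ≡⟨ cong (_++ [ rc x ]) (unfold-reverse (rc y) (map rc zs)) ⟩
  (reverse (map rc zs) ++ [ rc y ]) ++ [ rc x ]  ≡⟨ ++-assoc (reverse (map rc zs)) [ rc y ] [ rc x ] ⟩
  reverse (map rc zs) ++ rc y ∷ [ rc x ]         ∎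
  where open ≡-Reasoning

merge-reverse-rc : ∀ xs → merge (reverse (map rc xs)) ≡ rc (merge xs)
merge-reverse-rc []           = refl
merge-reverse-rc (x ∷ [])     = refl
merge-reverse-rc (x ∷ y ∷ zs) = begin
  merge (reverse (map rc (x ∷ y ∷ zs)))
    ≡⟨ cong merge (reverse-map-rc-∷-∷ x y zs) ⟩
  merge (R ++ rc y ∷ [ rc x ])
    ≡⟨ merge-∷ʳ-∷ʳ R (rc y) (rc x) ⟩
  merge (R ++ [ rc y ]) ++ drop (ov (rc y) (rc x)) (rc x)
    ≡⟨ cong₂ (λ u n → merge u ++ drop n (rc x)) (sym (unfold-reverse (rc y) (map rc zs))) (ov-rc x y) ⟩
  merge (reverse (map rc (y ∷ zs))) ++ drop (ov x y) (rc x)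
    ≡⟨ cong₂ _++_ (merge-reverse-rc (y ∷ zs)) (sym (rc-pref x y)) ⟩
  rc (merge (y ∷ zs)) ++ rc (pref x y)
    ≡⟨ rc-++ (pref x y) (merge (y ∷ zs)) ⟨
  rc (pref x y ++ merge (y ∷ zs))
    ∎
  where open ≡-Reasoning
        R : List Str
        R = reverse (map rc zs)

reverse-map-rc-loop : ∀ x xs → rc x ∷ reverse (map rc xs) ++ [ rc x ] ≡ reverse (map rc (x ∷ xs ++ [ x ]))
reverse-map-rc-loop x xs = sym (begin
  reverse (rc x ∷ map rc (xs ++ [ x ]))        ≡⟨ unfold-reverse (rc x) (map rc (xs ++ [ x ])) ⟩
  reverse (map rc (xs ++ [ x ])) ++ [ rc x ]   ≡⟨ cong (λ l → reverse l ++ [ rc x ]) (map-++ rc xs [ x ]) ⟩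
  reverse (map rc xs ++ [ rc x ]) ++ [ rc x ]  ≡⟨ cong (_++ [ rc x ]) (reverse-++ (map rc xs) [ rc x ]) ⟩
  rc x ∷ reverse (map rc xs) ++ [ rc x ]       ∎)
  where open ≡-Reasoning

-- Reversing and complementing a walk shifts its weight by the difference of the lengths of its ends,
-- so a closed walk keeps its weight; comparing the lengths of the merges avoids the subtraction.
pathWeight-rc-loop : ∀ x xs → pathWeight (rc x ∷ reverse (map rc xs) ++ [ rc x ]) ≡ pathWeight (x ∷ xs ++ [ x ])
pathWeight-rc-loop x xs = +-cancelʳ-≡ (length x) _ _ (begin
  pathWeight L′ + length x               ≡⟨ cong (pathWeight L′ +_) (length-rc x) ⟨
  pathWeight L′ + length (rc x)          ≡⟨ length-merge-∷ʳ (rc x ∷ reverse (map rc xs)) (rc x) ⟨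
  length (merge L′)                      ≡⟨ cong (length ∘ merge) (reverse-map-rc-loop x xs) ⟩
  length (merge (reverse (map rc L)))    ≡⟨ cong length (merge-reverse-rc L) ⟩
  length (rc (merge L))                  ≡⟨ length-rc (merge L) ⟩
  length (merge L)                       ≡⟨ length-merge-∷ʳ (x ∷ xs) x ⟩
  pathWeight L + length x                ∎)
  where open ≡-Reasoning
        L : List Str
        L = x ∷ xs ++ [ x ]
        L′ : List Str
        L′ = rc x ∷ reverse (map rc xs) ++ [ rc x ]

dist-++-≤ : ∀ d e f → 0 < length d → 0 < length f → dist (d ++ e) (e ++ f) ≤ length d
dist-++-≤ d e f 0<d 0<f = begin
  length x ∸ ov x y               ≤⟨ ∸-monoʳ-≤ (length x) (ov-maximal x y (length e) e<⊓ e-overlaps) ⟩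
  length x ∸ length e             ≡⟨ |x|∸|e| ⟩
  length d                        ∎
  where
  open ≤-Reasoning
  x : Str
  x = d ++ e
  y : Str
  y = e ++ f
  |x|∸|e| : length x ∸ length e ≡ length d
  |x|∸|e| = trans (cong (_∸ length e) (length-++ d)) (m+n∸n≡m (length d) (length e))
  e<⊓ : length e < length x ⊓ length y
  e<⊓ rewrite length-++ d {e} | length-++ e {f} = ⊓-glb (m<n+m (length e) 0<d) (m<m+n (length e) 0<f)
  e-overlaps : Overlap x y (length e)
  e-overlaps = trans (cong (λ n → drop n x) |x|∸|e|) (trans (drop-length-++ d e) (sym (take-length-++ e f)))

dist≤gap : ∀ x y w w′ d → x ++ w ≡ d ++ y ++ w′ → ¬ x ⊑ y → ¬ y ⊑ x → dist x y ≤ length d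
dist≤gap x y w w′ d eq x⋢y y⋢x with ++-split x w d (y ++ w′) eq
... | inj₁ (e , refl , _) =
  ≤-trans (m∸n≤m (length x) (ov x y)) (≤-trans (m≤m+n (length x) (length e)) (≤-reflexive (sym (length-++ x))))
... | inj₂ (e , refl , y++w′≡) with ++-split y w′ e w y++w′≡
...   | inj₁ (f , refl , _) = ⊥-elim (y⋢x (d , f , refl))
...   | inj₂ (f , refl , _) with d | f
...     | []      | f′      = ⊥-elim (x⋢y ([] , f′ , refl))
...     | d₁ ∷ ds | []      =
  ⊥-elim (y⋢x (d₁ ∷ ds , [] , cong ((d₁ ∷ ds) ++_) (trans (++-identityʳ (e ++ [])) (++-identityʳ e))))
...     | d₁ ∷ ds | f₁ ∷ fs = dist-++-≤ (d₁ ∷ ds) e (f₁ ∷ fs) (s≤s z≤n) (s≤s z≤n)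

dist+start≤start : ∀ x y u w u′ w′ → u ++ x ++ w ≡ u′ ++ y ++ w′ → length u ≤ length u′ →
                   ¬ x ⊑ y → ¬ y ⊑ x → dist x y + length u ≤ length u′
dist+start≤start x y u w u′ w′ eq u≤u′ x⋢y y⋢x with ++-split-≤ u (x ++ w) u′ (y ++ w′) eq u≤u′
... | d , refl , gap = begin
  dist x y + length u    ≤⟨ +-monoˡ-≤ (length u) (dist≤gap x y w w′ d gap x⋢y y⋢x) ⟩
  length d + length u    ≡⟨ +-comm (length d) (length u) ⟩
  length u + length d    ≡⟨ length-++ u ⟨
  length (u ++ d)        ∎
  where open ≤-Reasoning

IsTransversal : ∀ {m} → List (Vertex m) → Set
IsTransversal {m} P = map proj₁ P ↭ allFin m

module Occurrences {m} (S : Instance m) (z : Str) where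

  Occurrence : Set
  Occurrence = Σ (Vertex m) λ v → str S v ⊑ z

  start : Occurrence → ℕ
  start (_ , u , _) = length u

  index : Occurrence → Fin m
  index ((i , _) , _) = i

  string : Occurrence → Str
  string (v , _) = str S v

  open import Data.List.Sort (On.decTotalOrder ≤-decTotalOrder start) using (sort; sort-↭; sort-↗)

  length-merge+start≤length : SubstringFree S → ∀ o os →
                 Linked (λ o o′ → start o ≤ start o′) (o ∷ os) → Unique (map index (o ∷ os)) →
                 length (merge (map string (o ∷ os))) + start o ≤ length z
  length-merge+start≤length _ (v , u , w , refl) [] _ _ = begin
    length (str S v) + length u                ≡⟨ +-comm (length (str S v)) (length u) ⟩
    length u + length (str S v)                ≤⟨ +-monoʳ-≤ (length u) (m≤m+n (length (str S v)) (length w)) ⟩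
    length u + (length (str S v) + length w)   ≡⟨ cong (length u +_) (length-++ (str S v)) ⟨
    length u + length (str S v ++ w)           ≡⟨ length-++ u ⟨
    length (u ++ str S v ++ w)                 ∎
    where open ≤-Reasoning
  length-merge+start≤length sf (v , u , w , eq) (o′@(v′ , u′ , w′ , eq′) ∷ os)
                            (start≤ ∷ sorted) ((i≢i′ ∷ _) ∷ unique) = begin
    length (pref x y ++ M) + length u      ≡⟨ cong (_+ length u) (length-pref-++ x y M) ⟩
    (dist x y + length M) + length u       ≡⟨ xy∙z≈xz∙y (dist x y) (length M) (length u) ⟩
    (dist x y + length u) + length M       ≤⟨ +-monoˡ-≤ (length M) gap ⟩
    length u′ + length M                   ≡⟨ +-comm (length u′) (length M) ⟩
    length M + length u′                   ≤⟨ length-merge+start≤length sf o′ os sorted unique ⟩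
    length z                               ∎
    where
    open ≤-Reasoning
    x : Str
    x = str S v
    y : Str
    y = str S v′
    M : Str
    M = merge (map string (o′ ∷ os))
    gap : dist x y + length u ≤ length u′
    gap = dist+start≤start x y u w u′ w′ (trans eq (sym eq′)) start≤
            (λ x⊑y → i≢i′ (sf v v′ x⊑y)) (λ y⊑x → i≢i′ (sym (sf v′ v y⊑x)))

  length-merge≤length : SubstringFree S → ∀ os →
                        Linked (λ o o′ → start o ≤ start o′) os → Unique (map index os) →
                        length (merge (map string os)) ≤ length z
  length-merge≤length sf []       _      _      = z≤n
  length-merge≤length sf (o ∷ os) sorted unique =
    ≤-trans (m≤m+n _ (start o)) (length-merge+start≤length sf o os sorted unique)

  occurrence : ∀ i → (S i ⊑ z) ⊎ (rc (S i) ⊑ z) → Occurrence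
  occurrence i (inj₁ occ) = (i , false) , occ
  occurrence i (inj₂ occ) = (i , true) , occ

  index-occurrence : ∀ i occ → index (occurrence i occ) ≡ i
  index-occurrence i (inj₁ _) = refl
  index-occurrence i (inj₂ _) = refl

  sortedOccurrences : Solves (asList S) z → List Occurrence
  sortedOccurrences sol = sort (tabulate λ i → occurrence i (tabulate⁻ sol i))

  index-sortedOccurrences : ∀ sol → map index (sortedOccurrences sol) ↭ allFin m
  index-sortedOccurrences sol = subst (map index (sort Q) ↭_) indices (map⁺ index (sort-↭ Q))
    where
    Q : List Occurrence
    Q = tabulate λ i → occurrence i (tabulate⁻ sol i)
    indices : map index Q ≡ allFin m
    indices = trans (map-tabulate _ index) (tabulate-cong λ i → index-occurrence i (tabulate⁻ sol i))

  length-merge-sortedOccurrences : SubstringFree S → ∀ sol →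
                                   length (merge (map string (sortedOccurrences sol))) ≤ length z
  length-merge-sortedOccurrences sf sol = length-merge≤length sf _ (sort-↗ _) unique
    where
    unique : Unique (map index (sortedOccurrences sol))
    unique = Unique-resp-↭ (setoid (Fin m)) (↭⇒↭ₛ (↭-sym (index-sortedOccurrences sol))) (allFin⁺ m)

transversal-from-solution : ∀ {m} (S : Instance m) → SubstringFree S → ∀ z → Solves (asList S) z →
                            ∃[ P ] (IsTransversal P × length (merge (map (str S) P)) ≤ length z)
transversal-from-solution {m} S sf z sol =
  map proj₁ os ,
  subst (_↭ allFin m) (map-∘ os) (index-sortedOccurrences sol) ,
  subst (λ l → length (merge l) ≤ length z) (map-∘ os) (length-merge-sortedOccurrences sf sol)
  where
  open Occurrences S z
  os : List Occurrence
  os = sortedOccurrences sol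

singleCycle : ∀ {m} → List (Vertex m) → CycleCover m
singleCycle []       = []
singleCycle (v ∷ vs) = (v ∷⁺ vs) ∷ []

isCycleCover-singleCycle : ∀ {m} (P : List (Vertex m)) → IsTransversal P → IsCycleCover (singleCycle P)
isCycleCover-singleCycle []       P↭ = P↭
isCycleCover-singleCycle (v ∷ vs) P↭ = subst IsTransversal (sym (++-identityʳ (v ∷ vs))) P↭

weight-singleCycle≤ : ∀ {m} (S : Instance m) P → weight S (singleCycle P) ≤ length (merge (map (str S) P))
weight-singleCycle≤ S []       = z≤n
weight-singleCycle≤ S (v ∷ vs) = begin
  pathWeight (map (str S) ((v ∷ vs) ++ [ v ])) + 0      ≡⟨ +-identityʳ _ ⟩
  pathWeight (map (str S) ((v ∷ vs) ++ [ v ]))          ≡⟨ cong pathWeight (map-++ (str S) (v ∷ vs) [ v ]) ⟩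
  pathWeight (map (str S) (v ∷ vs) ++ [ str S v ])      ≤⟨ pathWeight-∷ʳ≤length-merge (map (str S) (v ∷ vs)) (str S v) ⟩
  length (merge (map (str S) (v ∷ vs)))                 ∎
  where open ≤-Reasoning

optimal-weight≤length-merge : ∀ {m} (S : Instance m) (C : CycleCover m) →
                              (∀ C′ → IsCycleCover C′ → weight S C ≤ weight S C′) →
                              ∀ P → IsTransversal P → weight S C ≤ length (merge (map (str S) P))
optimal-weight≤length-merge S C C-optimal P P↭ =
  ≤-trans (C-optimal (singleCycle P) (isCycleCover-singleCycle P P↭)) (weight-singleCycle≤ S P)

module Walk {m} (S : Instance m) (C : CycleCover m) where

  s′ : Vertex m → Str
  s′ = str S

  -- Meant for a cycle whose first vertex has the index of v: its other vertices, read in the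
  -- orientation of v, so that loop v cy goes once around the cycle starting and ending at v.
  interior : Vertex m → Cycle m → List Str
  interior v (h ∷⁺ tl) with proj₂ h Boolₚ.≟ proj₂ v
  ... | yes _ = map s′ tl
  ... | no _  = reverse (map rc (map s′ tl))

  loop : Vertex m → Cycle m → List Str
  loop v cy = s′ v ∷ interior v cy ++ [ s′ v ]

  detour : Vertex m → Cycle m → List Str
  detour v (h ∷⁺ tl) with proj₁ h Finₚ.≟ proj₁ v
  ... | yes _ = interior v (h ∷⁺ tl) ++ [ s′ v ]
  ... | no _  = []

  weightAt : Cycle m → Fin m → ℕ
  weightAt (h ∷⁺ tl) i with proj₁ h Finₚ.≟ i
  ... | yes _ = cycleWeight S (h ∷⁺ tl)
  ... | no _  = 0

  block : Vertex m → List Str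
  block v = s′ v ∷ concatMap (detour v) C

  walk : List (Vertex m) → List Str
  walk = concatMap block

  blockWeight : Vertex m → ℕ
  blockWeight v = sum (map (λ cy → weightAt cy (proj₁ v)) C)

  s′-flip : ∀ h v → proj₁ h ≡ proj₁ v → proj₂ h ≢ proj₂ v → s′ v ≡ rc (s′ h)
  s′-flip (i , false) (.i , false) refl b≢ = ⊥-elim (b≢ refl)
  s′-flip (i , false) (.i , true)  refl b≢ = refl
  s′-flip (i , true)  (.i , false) refl b≢ = sym (rc-involutive (S i))
  s′-flip (i , true)  (.i , true)  refl b≢ = ⊥-elim (b≢ refl)

  cycleWeight-∷⁺ : ∀ h tl → cycleWeight S (h ∷⁺ tl) ≡ pathWeight (s′ h ∷ map s′ tl ++ [ s′ h ])
  cycleWeight-∷⁺ h tl = cong (λ l → pathWeight (s′ h ∷ l)) (map-++ s′ tl [ h ])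

  pathWeight-loop : ∀ v h tl → proj₁ h ≡ proj₁ v →
                    pathWeight (loop v (h ∷⁺ tl)) ≡ cycleWeight S (h ∷⁺ tl)
  pathWeight-loop v h tl i≡ with proj₂ h Boolₚ.≟ proj₂ v
  ... | yes b≡ = begin
    pathWeight (s′ v ∷ map s′ tl ++ [ s′ v ])
      ≡⟨ cong (λ u → pathWeight (s′ u ∷ map s′ tl ++ [ s′ u ])) (cong₂ _,_ i≡ b≡) ⟨
    pathWeight (s′ h ∷ map s′ tl ++ [ s′ h ])
      ≡⟨ cycleWeight-∷⁺ h tl ⟨
    cycleWeight S (h ∷⁺ tl)
      ∎
    where open ≡-Reasoning
  ... | no b≢  = begin
    pathWeight (s′ v ∷ I ++ [ s′ v ])           ≡⟨ cong (λ x → pathWeight (x ∷ I ++ [ x ])) (s′-flip h v i≡ b≢) ⟩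
    pathWeight (rc (s′ h) ∷ I ++ [ rc (s′ h) ]) ≡⟨ pathWeight-rc-loop (s′ h) (map s′ tl) ⟩
    pathWeight (s′ h ∷ map s′ tl ++ [ s′ h ])   ≡⟨ cycleWeight-∷⁺ h tl ⟨
    cycleWeight S (h ∷⁺ tl)                     ∎
    where open ≡-Reasoning
          I : List Str
          I = reverse (map rc (map s′ tl))

  cycleString-⊑-loop : ∀ v h tl → proj₁ h ≡ proj₁ v →
                       cycleString S (h ∷⁺ tl) ⊑ merge (loop v (h ∷⁺ tl)) ⊎
                       rc (cycleString S (h ∷⁺ tl)) ⊑ merge (loop v (h ∷⁺ tl))
  cycleString-⊑-loop v h tl i≡ with proj₂ h Boolₚ.≟ proj₂ v
  ... | yes b≡ = inj₁ (subst (λ u → merge (s′ u ∷ map s′ tl) ⊑ merge (s′ v ∷ map s′ tl ++ [ s′ v ]))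
                              (sym (cong₂ _,_ i≡ b≡))
                              (merge-infix {s′ v ∷ map s′ tl} ([] , [ s′ v ] , refl)))
  ... | no b≢  = inj₂ (subst (_⊑ merge (s′ v ∷ I ++ [ s′ v ])) reversed
                              (merge-infix {I ++ [ s′ v ]}
                                 ([ s′ v ] , [] , cong (s′ v ∷_) (++-identityʳ (I ++ [ s′ v ])))))
    where
    I : List Str
    I = reverse (map rc (map s′ tl))
    reversed : merge (I ++ [ s′ v ]) ≡ rc (cycleString S (h ∷⁺ tl))
    reversed = begin
      merge (I ++ [ s′ v ])                       ≡⟨ cong (λ x → merge (I ++ [ x ])) (s′-flip h v i≡ b≢) ⟩
      merge (I ++ [ rc (s′ h) ])                  ≡⟨ cong merge (unfold-reverse (rc (s′ h)) (map rc (map s′ tl))) ⟨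
      merge (reverse (map rc (s′ h ∷ map s′ tl))) ≡⟨ merge-reverse-rc (s′ h ∷ map s′ tl) ⟩
      rc (cycleString S (h ∷⁺ tl))                ∎
      where open ≡-Reasoning

  detour-≡ : ∀ v h tl → proj₁ h ≡ proj₁ v → detour v (h ∷⁺ tl) ≡ interior v (h ∷⁺ tl) ++ [ s′ v ]
  detour-≡ v h tl i≡ with proj₁ h Finₚ.≟ proj₁ v
  ... | yes _ = refl
  ... | no i≢ = ⊥-elim (i≢ i≡)

  ∷-detours-∷ʳ : ∀ v Cs → ∃[ X ] s′ v ∷ concatMap (detour v) Cs ≡ X ++ [ s′ v ]
  ∷-detours-∷ʳ v [] = [] , refl
  ∷-detours-∷ʳ v ((h ∷⁺ tl) ∷ Cs) with proj₁ h Finₚ.≟ proj₁ v | ∷-detours-∷ʳ v Cs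
  ... | no _  | X , eq = X , eq
  ... | yes _ | X , eq = s′ v ∷ I ++ X , (begin
    s′ v ∷ (I ++ [ s′ v ]) ++ D   ≡⟨ cong (s′ v ∷_) (++-assoc I [ s′ v ] D) ⟩
    s′ v ∷ I ++ s′ v ∷ D          ≡⟨ cong (λ l → s′ v ∷ I ++ l) eq ⟩
    s′ v ∷ I ++ X ++ [ s′ v ]     ≡⟨ cong (s′ v ∷_) (++-assoc I X [ s′ v ]) ⟨
    (s′ v ∷ I ++ X) ++ [ s′ v ]   ∎)
    where open ≡-Reasoning
          I : List Str
          I = interior v (h ∷⁺ tl)
          D : List Str
          D = concatMap (detour v) Cs

  loop-infix-detours : ∀ v C₁ h tl C₂ → proj₁ h ≡ proj₁ v →
                       Infix (loop v (h ∷⁺ tl)) (s′ v ∷ concatMap (detour v) (C₁ ++ (h ∷⁺ tl) ∷ C₂))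
  loop-infix-detours v C₁ h tl C₂ i≡ with ∷-detours-∷ʳ v C₁
  ... | X , eq = X , D₂ , sym (begin
    s′ v ∷ concatMap (detour v) (C₁ ++ (h ∷⁺ tl) ∷ C₂)
      ≡⟨ cong (s′ v ∷_) (concatMap-++ (detour v) C₁ _) ⟩
    (s′ v ∷ concatMap (detour v) C₁) ++ detour v (h ∷⁺ tl) ++ D₂
      ≡⟨ cong₂ (λ l d → l ++ d ++ D₂) eq (detour-≡ v h tl i≡) ⟩
    (X ++ [ s′ v ]) ++ (interior v (h ∷⁺ tl) ++ [ s′ v ]) ++ D₂
      ≡⟨ ++-assoc X [ s′ v ] _ ⟩
    X ++ loop v (h ∷⁺ tl) ++ D₂
      ∎)
    where open ≡-Reasoning
          D₂ : List Str
          D₂ = concatMap (detour v) C₂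

  loop-infix-walk : ∀ P v h tl → v ∈ P → (h ∷⁺ tl) ∈ C → proj₁ h ≡ proj₁ v →
                    Infix (loop v (h ∷⁺ tl)) (walk P)
  loop-infix-walk P v h tl v∈P cy∈C i≡ with ∈-∃++ v∈P | ∈-∃++ cy∈C
  ... | P₁ , P₂ , refl | C₁ , C₂ , C≡ =
    subst (Infix (loop v (h ∷⁺ tl))) (sym (concatMap-++ block P₁ (v ∷ P₂)))
      (infix-++ˡ (walk P₁) (infix-++ʳ (walk P₂)
        (subst (λ Cs → Infix (loop v (h ∷⁺ tl)) (s′ v ∷ concatMap (detour v) Cs)) (sym C≡)
          (loop-infix-detours v C₁ h tl C₂ i≡))))

  walk-solves : ∀ P → IsTransversal P → Solves (Tset S C) (merge (walk P))
  walk-solves P P↭ = All-map⁺ (All.tabulate λ {cy} → cycleString-⊑-walk cy)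
    where
    cycleString-⊑-walk : ∀ cy → cy ∈ C →
                         cycleString S cy ⊑ merge (walk P) ⊎ rc (cycleString S cy) ⊑ merge (walk P)
    cycleString-⊑-walk (h ∷⁺ tl) cy∈C with ∈-map⁻ proj₁ (∈-resp-↭ (↭-sym P↭) (∈-allFin (proj₁ h)))
    ... | v , v∈P , i≡ = Sum.map (λ ⊑loop → infix-trans ⊑loop ⊑walk) (λ ⊑loop → infix-trans ⊑loop ⊑walk)
                                 (cycleString-⊑-loop v h tl i≡)
      where ⊑walk : merge (loop v (h ∷⁺ tl)) ⊑ merge (walk P)
            ⊑walk = merge-infix (loop-infix-walk P v h tl v∈P cy∈C i≡)

  length-merge-detours : ∀ v Cs R → length (merge (s′ v ∷ concatMap (detour v) Cs ++ R)) ≡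
                         sum (map (λ cy → weightAt cy (proj₁ v)) Cs) + length (merge (s′ v ∷ R))
  length-merge-detours v []              R = refl
  length-merge-detours v ((h ∷⁺ tl) ∷ Cs) R with proj₁ h Finₚ.≟ proj₁ v
  ... | no _   = length-merge-detours v Cs R
  ... | yes i≡ = begin
    length (merge (s′ v ∷ ((I ++ [ s′ v ]) ++ D) ++ R))
      ≡⟨ cong (λ l → length (merge (s′ v ∷ l)))
              (trans (++-assoc (I ++ [ s′ v ]) D R) (++-assoc I [ s′ v ] (D ++ R))) ⟩
    length (merge ((s′ v ∷ I) ++ s′ v ∷ D ++ R))
      ≡⟨ cong length (merge-++ (s′ v ∷ I) (s′ v) (D ++ R)) ⟩
    length (prefs (loop v (h ∷⁺ tl)) ++ merge (s′ v ∷ D ++ R))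
      ≡⟨ length-++ (prefs (loop v (h ∷⁺ tl))) ⟩
    length (prefs (loop v (h ∷⁺ tl))) + length (merge (s′ v ∷ D ++ R))
      ≡⟨ cong₂ _+_ (trans (length-prefs (loop v (h ∷⁺ tl))) (pathWeight-loop v h tl i≡))
                   (length-merge-detours v Cs R) ⟩
    cycleWeight S (h ∷⁺ tl) + (sum (map (λ cy → weightAt cy (proj₁ v)) Cs) + length (merge (s′ v ∷ R)))
      ≡⟨ +-assoc (cycleWeight S (h ∷⁺ tl)) _ _ ⟨
    cycleWeight S (h ∷⁺ tl) + sum (map (λ cy → weightAt cy (proj₁ v)) Cs) + length (merge (s′ v ∷ R))
      ∎
    where open ≡-Reasoning
          I : List Str
          I = interior v (h ∷⁺ tl)
          D : List Str
          D = concatMap (detour v) Cs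

  length-merge-∷-walk : ∀ x P → length (merge (x ∷ walk P)) ≡
                        sum (map blockWeight P) + length (merge (x ∷ map s′ P))
  length-merge-∷-walk x []      = refl
  length-merge-∷-walk x (u ∷ P) = begin
    length (pref x (s′ u) ++ merge (block u ++ walk P))
      ≡⟨ length-pref-++ x (s′ u) _ ⟩
    dist x (s′ u) + length (merge (block u ++ walk P))
      ≡⟨ cong (dist x (s′ u) +_) (length-merge-detours u C (walk P)) ⟩
    dist x (s′ u) + (blockWeight u + length (merge (s′ u ∷ walk P)))
      ≡⟨ cong (λ n → dist x (s′ u) + (blockWeight u + n)) (length-merge-∷-walk (s′ u) P) ⟩
    dist x (s′ u) + (blockWeight u + (sum (map blockWeight P) + length (merge (s′ u ∷ map s′ P))))
      ≡⟨ cong (dist x (s′ u) +_) (+-assoc (blockWeight u) _ _) ⟨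
    dist x (s′ u) + ((blockWeight u + sum (map blockWeight P)) + length (merge (s′ u ∷ map s′ P)))
      ≡⟨ x∙yz≈y∙xz (dist x (s′ u)) (blockWeight u + sum (map blockWeight P)) _ ⟩
    (blockWeight u + sum (map blockWeight P)) + (dist x (s′ u) + length (merge (s′ u ∷ map s′ P)))
      ≡⟨ cong (blockWeight u + sum (map blockWeight P) +_) (length-pref-++ x (s′ u) _) ⟨
    (blockWeight u + sum (map blockWeight P)) + length (pref x (s′ u) ++ merge (s′ u ∷ map s′ P))
      ∎
    where open ≡-Reasoning

  length-merge-walk-sum : ∀ P → length (merge (walk P)) ≡ sum (map blockWeight P) + length (merge (map s′ P))
  length-merge-walk-sum []      = refl
  length-merge-walk-sum (v ∷ P) = begin
    length (merge (block v ++ walk P))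
      ≡⟨ length-merge-detours v C (walk P) ⟩
    blockWeight v + length (merge (s′ v ∷ walk P))
      ≡⟨ cong (blockWeight v +_) (length-merge-∷-walk (s′ v) P) ⟩
    blockWeight v + (sum (map blockWeight P) + length (merge (map s′ (v ∷ P))))
      ≡⟨ +-assoc (blockWeight v) _ _ ⟨
    blockWeight v + sum (map blockWeight P) + length (merge (map s′ (v ∷ P)))
      ∎
    where open ≡-Reasoning

  sum-weightAt : ∀ cy → sum (map (weightAt cy) (allFin m)) ≡ cycleWeight S cy
  sum-weightAt (h ∷⁺ tl) = begin
    sum (map (weightAt (h ∷⁺ tl)) (allFin m)) ≡⟨ cong sum (map-tabulate (λ i → i) (weightAt (h ∷⁺ tl))) ⟩
    sum (tabulate (weightAt (h ∷⁺ tl)))       ≡⟨ sum-tabulate-indicator (weightAt (h ∷⁺ tl)) (proj₁ h) weightAt-≢ ⟩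
    weightAt (h ∷⁺ tl) (proj₁ h)              ≡⟨ weightAt-head ⟩
    cycleWeight S (h ∷⁺ tl)                   ∎
    where
    open ≡-Reasoning
    weightAt-≢ : ∀ i → proj₁ h ≢ i → weightAt (h ∷⁺ tl) i ≡ 0
    weightAt-≢ i i≢ with proj₁ h Finₚ.≟ i
    ... | yes i≡ = ⊥-elim (i≢ i≡)
    ... | no _   = refl
    weightAt-head : weightAt (h ∷⁺ tl) (proj₁ h) ≡ cycleWeight S (h ∷⁺ tl)
    weightAt-head with proj₁ h Finₚ.≟ proj₁ h
    ... | yes _ = refl
    ... | no i≢ = ⊥-elim (i≢ refl)

  sum-blockWeight : ∀ P → IsTransversal P → sum (map blockWeight P) ≡ weight S C
  sum-blockWeight P P↭ = begin
    sum (map blockWeight P)                                     ≡⟨ cong sum (map-∘ P) ⟩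
    sum (map G (map proj₁ P))                                   ≡⟨ sum-↭ (map⁺ G P↭) ⟩
    sum (map G (allFin m))                                      ≡⟨ sum-map-comm weightAt C (allFin m) ⟩
    sum (map (λ cy → sum (map (weightAt cy) (allFin m))) C)     ≡⟨ cong sum (map-cong sum-weightAt C) ⟩
    weight S C                                                  ∎
    where open ≡-Reasoning
          G : Fin m → ℕ
          G i = sum (map (λ cy → weightAt cy i) C)

  length-merge-walk : ∀ P → IsTransversal P → length (merge (walk P)) ≡ weight S C + length (merge (map s′ P))
  length-merge-walk P P↭ = trans (length-merge-walk-sum P) (cong (_+ length (merge (map s′ P))) (sum-blockWeight P P↭))

lemma15 : ∀ {m} (S : Instance m) → SubstringFree S →
          (C : CycleCover m) → IsOptimalCycleCover S C →
          (optS optT : ℕ) → IsOPT (asList S) optS → IsOPT (Tset S C) optT →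
          (optT ≤ optS + weight S C) × (optS + weight S C ≤ 2 * optS)
lemma15 S sf C (_ , C-optimal) optS optT ((z , z-solves , |z|≡optS) , _) (_ , optT-minimal) =
  bounds (transversal-from-solution S sf z z-solves)
  where
  open ≤-Reasoning
  open Walk S C using (walk; walk-solves; length-merge-walk)
  bounds : ∃[ P ] (IsTransversal P × length (merge (map (str S) P)) ≤ length z) →
           (optT ≤ optS + weight S C) × (optS + weight S C ≤ 2 * optS)
  bounds (P , P↭ , |merge|≤|z|) = optT≤ , optS+w≤
    where
    |merge|≤optS : length (merge (map (str S) P)) ≤ optS
    |merge|≤optS = ≤-trans |merge|≤|z| (≤-reflexive |z|≡optS)
    optT≤ : optT ≤ optS + weight S C
    optT≤ = begin
      optT                                         ≤⟨ optT-minimal (merge (walk P)) (walk-solves P P↭) ⟩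
      length (merge (walk P))                      ≡⟨ length-merge-walk P P↭ ⟩
      weight S C + length (merge (map (str S) P))  ≤⟨ +-monoʳ-≤ (weight S C) |merge|≤optS ⟩
      weight S C + optS                            ≡⟨ +-comm (weight S C) optS ⟩
      optS + weight S C                            ∎
    optS+w≤ : optS + weight S C ≤ 2 * optS
    optS+w≤ = begin
      optS + weight S C  ≤⟨ +-monoʳ-≤ optS (≤-trans (optimal-weight≤length-merge S C C-optimal P P↭) |merge|≤optS) ⟩
      optS + optS        ≡⟨ cong (optS +_) (+-identityʳ optS) ⟨
      2 * optS           ∎
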